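{- Let $\Theta_{var}$ be a finite set of atomic substitutions and let $X$ be a finite set of variables. Then every substitution in the partial-substitution closure $\mathcal{C}_{ps}(\Theta_{var},X)$ is atomic, and $\mathcal{C}_{ps}(\Theta_{var},X)$ is finite.
   Context: A substitution is a finite map from variables to first-order terms; it is atomic if its image contains only variables and constant symbols. For substitutions $\theta_1,\theta_2$, $\theta_1\theta_2$ denotes their composition, satisfying $\phi[\theta_1\theta_2]=(\phi[\theta_1])[\theta_2]$. For variables $x,y$, $\theta[x\to y]$ is the substitution obtained from $\theta$ by setting the image of $x$ to $y$. For a finite set of substitutions $\Theta$ and a finite set of variables $X$, the partial-substitution closure $\mathcal{C}_{ps}(\Theta,X)$ is the smallest set $S$ of substitutions such that $\Theta\subseteq S$; for all $\theta\in S$ and $x,y\in X$, $\theta[x\to y]\in S$; and for all $\theta_1,\theta_2\in S$, $\theta_1\theta_2\in S$. -}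

module Defs where

open import Data.Nat using (ℕ; _≟_)
open import Data.Product using (_×_; _,_; ∃-syntax; Σ-syntax)
open import Data.List using (List; []; _∷_; _++_)
open import Data.List.Membership.Propositional using (_∈_)
open import Data.Vec using (Vec; []; _∷_)
open import Data.Maybe using (Maybe; just; nothing)
open import Relation.Binary.PropositionalEquality using (_≡_)
open import Relation.Nullary using (yes; no)

module _ (Sym : Set) (ar : Sym → ℕ) where

  Var : Set
  Var = ℕ

  data Term : Set where
    var : Var → Term
    app : (f : Sym) → Vec Term (ar f) → Term

  -- A substitution is a finite map Var ⇀ Term, represented as an
  -- association list (first binding wins).
  Subst : Set
  Subst = List (Var × Term)

  lookupS : Subst → Var → Maybe Term
  lookupS [] x = nothing
  lookupS ((y , t) ∷ θ) x with x ≟ y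
  ... | yes _ = just t
  ... | no  _ = lookupS θ x

  mutual
    applyS : Subst → Term → Term
    applyS θ (var x) with lookupS θ x
    ... | just t  = t
    ... | nothing = var x
    applyS θ (app f ts) = app f (applyV θ ts)

    applyV : ∀ {n} → Subst → Vec Term n → Vec Term n
    applyV θ [] = []
    applyV θ (t ∷ ts) = applyS θ t ∷ applyV θ ts

  -- composition θ₁θ₂ : x ↦ θ₁(x)[θ₂] if x ∈ dom θ₁, else θ₂(x);
  -- so that φ[θ₁θ₂] = (φ[θ₁])[θ₂].
  mapImg : Subst → Subst → Subst
  mapImg [] θ₂ = []
  mapImg ((x , t) ∷ θ₁) θ₂ = (x , applyS θ₂ t) ∷ mapImg θ₁ θ₂

  _⊙_ : Subst → Subst → Subst
  θ₁ ⊙ θ₂ = mapImg θ₁ θ₂ ++ θ₂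

  _[_↦_] : Subst → Var → Var → Subst
  θ [ x ↦ y ] = (x , var y) ∷ θ

  _≐_ : Subst → Subst → Set
  θ ≐ σ = ∀ x → lookupS θ x ≡ lookupS σ x

  data AtomicTerm : Term → Set where
    isVar   : ∀ x → AtomicTerm (var x)
    isConst : ∀ f (ts : Vec Term (ar f)) → ar f ≡ 0 → AtomicTerm (app f ts)

  Atomic : Subst → Set
  Atomic θ = ∀ x t → lookupS θ x ≡ just t → AtomicTerm t

  data Cps (Θ : List Subst) (X : List Var) : Subst → Set where
    base : ∀ {θ} → θ ∈ Θ → Cps Θ X θ
    upd  : ∀ {θ x y} → Cps Θ X θ → x ∈ X → y ∈ X → Cps Θ X (θ [ x ↦ y ])
    comp : ∀ {θ₁ θ₂} → Cps Θ X θ₁ → Cps Θ X θ₂ → Cps Θ X (θ₁ ⊙ θ₂)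

  -- a set of substitutions (as finite maps) is finite: it is covered,
  -- up to extensional equality of finite maps, by a finite list
  FiniteSet : (Subst → Set) → Set
  FiniteSet P = ∃[ L ] (∀ θ → P θ → ∃[ σ ] (σ ∈ L × θ ≐ σ))

-- Every substitution of the closure has its domain inside D = dom Θ ∪ X and
-- its image inside the finite list V of atomic terms made of the images of
-- the members of Θ and the variables of X: updates x ↦ y stay there, and
-- applying such a substitution to an atomic term of V lands again in V, so
-- compositions stay there too. Finitely many finite maps have domain within
-- D and image within V, and atomicity is inherited from V.
module Submission where

open import Defs
open import Data.Nat using (ℕ; _≟_)
open import Data.Product using (_×_; _,_; proj₁; proj₂)
open import Data.Sum using (_⊎_; inj₁; inj₂)
open import Data.List using (List; []; _∷_; _++_; map; concatMap; mapMaybe)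
open import Data.List.Membership.Propositional using (_∈_)
open import Data.List.Membership.Propositional.Properties
  using (∈-++⁺ˡ; ∈-++⁺ʳ; ∈-map⁺; ∈-concatMap⁺)
open import Data.List.Relation.Unary.All as All using (All)
import Data.List.Relation.Unary.All.Properties as All
open import Data.List.Relation.Unary.Any as Any using (here; there)
import Data.List.Relation.Unary.Any.Properties as Any
open import Data.Maybe as Maybe using (Maybe; just; nothing; _<∣>_)
import Data.Maybe.Relation.Unary.All as MaybeAll
import Data.Maybe.Relation.Unary.Any as MaybeAny
open import Data.Vec using (Vec; [])
open import Data.Empty using (⊥-elim)
open import Relation.Binary.PropositionalEquality using (_≡_; refl; sym; trans; cong; subst)
open import Relation.Nullary using (yes; no; ¬_)

module Closure (Sym : Set) (ar : Sym → ℕ) where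

  private
    Tm : Set
    Tm = Term Sym ar

    Sub : Set
    Sub = Subst Sym ar

    lookup : Sub → Var Sym ar → Maybe Tm
    lookup = lookupS Sym ar

    apply : Sub → Tm → Tm
    apply = applyS Sym ar

    _∘ˢ_ : Sub → Sub → Sub
    _∘ˢ_ = _⊙_ Sym ar

  dom : Sub → List ℕ
  dom = map proj₁

  imageOn : List ℕ → Sub → List Tm
  imageOn D θ = mapMaybe (lookup θ) D

  record Bounded (D : List ℕ) (V : List Tm) (θ : Sub) : Set where
    constructor bounded
    field bounds : ∀ x t → lookup θ x ≡ just t → x ∈ D × t ∈ V
  open Bounded

  lookup-head : ∀ {x y t} θ → x ≡ y → lookup ((y , t) ∷ θ) x ≡ just t
  lookup-head {x} {y} θ x≡y with x ≟ y
  ... | yes _  = refl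
  ... | no x≢y = ⊥-elim (x≢y x≡y)

  lookup-tail : ∀ {x y t} θ → ¬ x ≡ y → lookup ((y , t) ∷ θ) x ≡ lookup θ x
  lookup-tail {x} {y} θ x≢y with x ≟ y
  ... | yes x≡y = ⊥-elim (x≢y x≡y)
  ... | no _    = refl

  lookup⇒∈dom : ∀ θ {x t} → lookup θ x ≡ just t → x ∈ dom θ
  lookup⇒∈dom ((y , _) ∷ θ) {x} eq with x ≟ y
  ... | yes x≡y = here x≡y
  ... | no _    = there (lookup⇒∈dom θ eq)

  lookup⇒∈imageOn : ∀ θ {D x t} → x ∈ D → lookup θ x ≡ just t → t ∈ imageOn D θ
  lookup⇒∈imageOn θ {D} x∈D eq =
    Any.mapMaybe⁺ (lookup θ) D (Any.map⁺ (Any.map (λ { refl → found }) x∈D))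
    where
    found : MaybeAny.Any (_ ≡_) (lookup θ _)
    found = subst (MaybeAny.Any (_ ≡_)) (sym eq) (MaybeAny.just refl)

  imageOn-atomic : ∀ θ D → Atomic Sym ar θ → All (AtomicTerm Sym ar) (imageOn D θ)
  imageOn-atomic θ D atomic = All.mapMaybe⁺ (All.map⁺ (All.universal atomicAt D))
    where
    atomicAt : ∀ x → MaybeAll.All (AtomicTerm Sym ar) (lookup θ x)
    atomicAt x with lookup θ x in eq
    ... | just t  = MaybeAll.just (atomic x t eq)
    ... | nothing = MaybeAll.nothing

  bounded⇒atomic : ∀ {D V θ} → All (AtomicTerm Sym ar) V → Bounded D V θ → Atomic Sym ar θ
  bounded⇒atomic atomicV θ-bounded x t eq = All.lookup atomicV (proj₂ (bounds θ-bounded x t eq))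

  apply-const : ∀ θ {f} ts → ar f ≡ 0 → apply θ (app f ts) ≡ app f ts
  apply-const θ {f} ts f-const = cong (app f) (applyV-nullary ts f-const)
    where
    applyV-nullary : ∀ {n} (ts : Vec Tm n) → n ≡ 0 → applyV Sym ar θ ts ≡ ts
    applyV-nullary [] refl = refl

  apply-bounded : ∀ {D V θ t} → Bounded D V θ → AtomicTerm Sym ar t → t ∈ V → apply θ t ∈ V
  apply-bounded {θ = θ} θ-bounded (isVar x) x∈V with lookup θ x in eq
  ... | just s  = proj₂ (bounds θ-bounded x s eq)
  ... | nothing = x∈V
  apply-bounded {V = V} {θ} _ (isConst f ts f-const) c∈V =
    subst (_∈ V) (sym (apply-const θ ts f-const)) c∈V

  lookup-⊙ : ∀ θ₁ θ₂ x → lookup (θ₁ ∘ˢ θ₂) x ≡ (Maybe.map (apply θ₂) (lookup θ₁ x) <∣> lookup θ₂ x)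
  lookup-⊙ [] θ₂ x = refl
  lookup-⊙ ((y , t) ∷ θ₁) θ₂ x with x ≟ y
  ... | yes _ = refl
  ... | no _  = lookup-⊙ θ₁ θ₂ x

  bounded-⊙ : ∀ {D V θ₁ θ₂} → All (AtomicTerm Sym ar) V →
              Bounded D V θ₁ → Bounded D V θ₂ → Bounded D V (θ₁ ∘ˢ θ₂)
  bounded-⊙ {D} {V} {θ₁} {θ₂} atomicV θ₁-bounded θ₂-bounded = bounded bound
    where
    bound : ∀ x t → lookup (θ₁ ∘ˢ θ₂) x ≡ just t → x ∈ D × t ∈ V
    bound x t eq rewrite lookup-⊙ θ₁ θ₂ x with lookup θ₁ x in eq₁ | eq
    ... | nothing | eq₂  = bounds θ₂-bounded x t eq₂
    ... | just s  | refl =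
      let x∈D , s∈V = bounds θ₁-bounded x s eq₁
      in x∈D , apply-bounded θ₂-bounded (All.lookup atomicV s∈V) s∈V

  bounded-update : ∀ {D V θ x y} → x ∈ D → var y ∈ V → Bounded D V θ →
                   Bounded D V (_[_↦_] Sym ar θ x y)
  bounded-update {D} {V} {θ} {x} {y} x∈D y∈V θ-bounded = bounded bound
    where
    bound : ∀ z t → lookup (_[_↦_] Sym ar θ x y) z ≡ just t → z ∈ D × t ∈ V
    bound z t eq with z ≟ x | eq
    ... | yes refl | refl = x∈D , y∈V
    ... | no _     | eq′  = bounds θ-bounded z t eq′

  restrict : Sub → List ℕ → Sub
  restrict θ [] = []
  restrict θ (d ∷ D) with lookup θ d
  ... | just t  = (d , t) ∷ restrict θ D
  ... | nothing = restrict θ D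

  private
    narrow : ∀ θ {x d D} → x ∈ d ∷ D ⊎ lookup θ x ≡ nothing → ¬ x ≡ d →
             x ∈ D ⊎ lookup θ x ≡ nothing
    narrow _ (inj₁ (here x≡d)) x≢d = ⊥-elim (x≢d x≡d)
    narrow _ (inj₁ (there x∈D)) _  = inj₁ x∈D
    narrow _ (inj₂ unbound) _      = inj₂ unbound

  lookup-restrict : ∀ θ D {x} → x ∈ D ⊎ lookup θ x ≡ nothing →
                    lookup (restrict θ D) x ≡ lookup θ x
  lookup-restrict θ [] (inj₂ unbound) = sym unbound
  lookup-restrict θ (d ∷ D) {x} relevant with lookup θ d in eq | x ≟ d
  ... | just t  | yes refl = trans (lookup-head {d} (restrict θ D) refl) (sym eq)
  ... | nothing | yes refl = lookup-restrict θ D (inj₂ eq)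
  ... | just t  | no x≢d   =
    trans (lookup-tail {x} (restrict θ D) x≢d) (lookup-restrict θ D (narrow θ relevant x≢d))
  ... | nothing | no x≢d   = lookup-restrict θ D (narrow θ relevant x≢d)

  enumerate : List ℕ → List Tm → List Sub
  enumerate []      V = [] ∷ []
  enumerate (d ∷ D) V = concatMap (λ σ → σ ∷ map (λ t → (d , t) ∷ σ) V) (enumerate D V)

  restrict∈enumerate : ∀ θ D {V} → (∀ x t → lookup θ x ≡ just t → t ∈ V) →
                       restrict θ D ∈ enumerate D V
  restrict∈enumerate θ []      image⊆V = here refl
  restrict∈enumerate θ (d ∷ D) image⊆V with lookup θ d in eq
  ... | just t  = ∈-concatMap⁺ _ (Any.map (λ { refl → there (∈-map⁺ _ (image⊆V d t eq)) })
                                          (restrict∈enumerate θ D image⊆V))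
  ... | nothing = ∈-concatMap⁺ _ (Any.map (λ { refl → here refl })
                                          (restrict∈enumerate θ D image⊆V))

  finite-⊆ : ∀ {P Q : Sub → Set} → (∀ θ → P θ → Q θ) → FiniteSet Sym ar Q → FiniteSet Sym ar P
  finite-⊆ P⊆Q (L , covers) = L , λ θ Pθ → covers θ (P⊆Q θ Pθ)

  bounded-finite : ∀ D V → FiniteSet Sym ar (Bounded D V)
  bounded-finite D V = enumerate D V , λ θ θ-bounded →
    restrict θ D ,
    restrict∈enumerate θ D (λ x t eq → proj₂ (bounds θ-bounded x t eq)) ,
    λ x → sym (lookup-restrict θ D (relevant θ θ-bounded x))
    where
    relevant : ∀ θ → Bounded D V θ → ∀ x → x ∈ D ⊎ lookup θ x ≡ nothing
    relevant θ θ-bounded x with lookup θ x in eq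
    ... | just t  = inj₁ (proj₁ (bounds θ-bounded x t eq))
    ... | nothing = inj₂ refl

  module _ (Θ : List Sub) (X : List ℕ) where

    closureDom : List ℕ
    closureDom = concatMap dom Θ ++ X

    closureImage : List Tm
    closureImage = concatMap (imageOn closureDom) Θ ++ map var X

    closureImage-atomic : (∀ θ → θ ∈ Θ → Atomic Sym ar θ) →
                          All (AtomicTerm Sym ar) closureImage
    closureImage-atomic atomicΘ =
      All.++⁺ (All.concat⁺ (All.map⁺ (All.tabulate λ {θ} θ∈Θ →
                 imageOn-atomic θ closureDom (atomicΘ θ θ∈Θ))))
              (All.map⁺ (All.universal isVar X))

    member-bounded : ∀ {θ} → θ ∈ Θ → Bounded closureDom closureImage θ
    member-bounded {θ} θ∈Θ = bounded λ x t eq →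
      let x∈closureDom = ∈-++⁺ˡ (∈-concatMap⁺ _ (Any.map (λ { refl → lookup⇒∈dom θ eq }) θ∈Θ))
          t∈image = lookup⇒∈imageOn θ x∈closureDom eq
      in x∈closureDom , ∈-++⁺ˡ (∈-concatMap⁺ _ (Any.map (λ { refl → t∈image }) θ∈Θ))

    Cps-bounded : (∀ θ → θ ∈ Θ → Atomic Sym ar θ) →
                  ∀ {θ} → Cps Sym ar Θ X θ → Bounded closureDom closureImage θ
    Cps-bounded atomicΘ (base θ∈Θ) = member-bounded θ∈Θ
    Cps-bounded atomicΘ (upd c x∈X y∈X) =
      bounded-update (∈-++⁺ʳ _ x∈X) (∈-++⁺ʳ _ (∈-map⁺ var y∈X)) (Cps-bounded atomicΘ c)
    Cps-bounded atomicΘ (comp c₁ c₂) =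
      bounded-⊙ (closureImage-atomic atomicΘ) (Cps-bounded atomicΘ c₁) (Cps-bounded atomicΘ c₂)

lemma3 : (Sym : Set) (ar : Sym → ℕ) (Θ : List (Subst Sym ar)) (X : List ℕ) →
         (∀ θ → θ ∈ Θ → Atomic Sym ar θ) →
         (∀ θ → Cps Sym ar Θ X θ → Atomic Sym ar θ) × FiniteSet Sym ar (Cps Sym ar Θ X)
lemma3 Sym ar Θ X atomicΘ =
  (λ θ c → bounded⇒atomic (closureImage-atomic Θ X atomicΘ) (closure-bounded c)) ,
  finite-⊆ (λ θ → closure-bounded) (bounded-finite (closureDom Θ X) (closureImage Θ X))
  where
  open Closure Sym ar
  closure-bounded : ∀ {θ} → Cps Sym ar Θ X θ → Bounded (closureDom Θ X) (closureImage Θ X) θ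
  closure-bounded = Cps-bounded Θ X atomicΘ
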